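{- Let $C$ be a small category, $\mathbb{K}$ a presheaf on $C$, and $\top$ a global element of $\mathbb{K}$. Let $\Gamma$ be a presheaf on $C$ and $\phi : \Gamma \to \mathbb{K}$ a morphism; write $\Gamma,[\phi]$ for the subpresheaf of $\Gamma$ consisting of those $\gamma \in \Gamma(c)$ with $\phi_c(\gamma) = \top_c$. Let $T$ be a type over $\Gamma$ and $A$ a type over $\Gamma,[\phi]$, and suppose that over $\Gamma,[\phi]$ there are mutually inverse morphisms of types $\alpha : A \to T$ and $\beta : T \to A$ (where $T$ is restricted to $\Gamma,[\phi]$). Then there exists a type $\mathcal{T}(A,T,\phi)$ over $\Gamma$ such that: (1) the restriction of $\mathcal{T}(A,T,\phi)$ to $\Gamma,[\phi]$ is equal to $A$; (2) there are mutually inverse morphisms of types $\alpha' : \mathcal{T}(A,T,\phi) \to T$ and $\beta' : T \to \mathcal{T}(A,T,\phi)$ over $\Gamma$ whose restrictions to $\Gamma,[\phi]$ are $\alpha$ and $\beta$ respectively; (3) for every morphism $\rho : \Delta \to \Gamma$ of presheaves, with induced $\Delta,[\phi\rho] \to \Gamma,[\phi]$, we have $\mathcal{T}(A,T,\phi)\rho = \mathcal{T}(A\rho,T\rho,\phi\rho)$.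
   Context: In the presheaf interpretation of dependent type theory, a type over a presheaf (context) $\Gamma$ on $C$ is a presheaf on the category of elements of $\Gamma$, i.e. an assignment of a set $A(c,\gamma)$ to each $c \in C$ and $\gamma \in \Gamma(c)$, with restriction maps $A(c,\gamma) \to A(d, \Gamma(f)(\gamma))$ for $f : d \to c$, functorially. A morphism of types over $\Gamma$ is a natural transformation between such presheaves. For $\rho : \Delta \to \Gamma$, the substituted type $A\rho$ is given by $(A\rho)(c,\delta) = A(c,\rho_c(\delta))$. The equalities in (1) and (3) are strict equalities of presheaves. -}

module Defs where

open import Data.Product using (Σ; _,_; proj₁; proj₂)
open import Relation.Binary.PropositionalEquality
  using (_≡_; refl; sym; trans; cong; subst)
open import Relation.Nullary using (Dec)
open import Axiom.UniquenessOfIdentityProofs using (UIP; module Constant⇒UIP)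

IsProp : Set → Set
IsProp P = (x y : P) → x ≡ y

-- Excluded middle for propositions (the classical metatheory of the paper)
LEM : Set₁
LEM = (P : Set) → IsProp P → Dec P

coe : {X Y : Set} → X ≡ Y → X → Y
coe = subst (λ X → X)

Σ-≡ : {A : Set} {B : A → Set} → (∀ a → IsProp (B a)) →
      {x y : Σ A B} → proj₁ x ≡ proj₁ y → x ≡ y
Σ-≡ irr {a , b} {.a , b'} refl = cong (a ,_) (irr a b b')

Σ-UIP : {A : Set} {B : A → Set} → UIP A → (∀ a → IsProp (B a)) → UIP (Σ A B)
Σ-UIP {A} {B} uA irr =
  Constant⇒UIP.≡-irrelevant
    (λ p → Σ-≡ irr (cong proj₁ p))
    (λ p q → cong (Σ-≡ irr) (uA (cong proj₁ p) (cong proj₁ q)))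

-- Small categories.  Hom d c is the set of arrows d → c;
-- f ∘ g is "f after g".

record Category : Set₁ where
  infixr 9 _∘_
  field
    Obj   : Set
    Hom   : Obj → Obj → Set
    Hom-set : ∀ {d c} → UIP (Hom d c)
    idC   : ∀ {c} → Hom c c
    _∘_   : ∀ {c d e} → Hom d c → Hom e d → Hom e c
    idˡ   : ∀ {c d} (f : Hom d c) → idC ∘ f ≡ f
    idʳ   : ∀ {c d} (f : Hom d c) → f ∘ idC ≡ f
    assoc : ∀ {a b c d} (f : Hom c d) (g : Hom b c) (h : Hom a b) →
            (f ∘ g) ∘ h ≡ f ∘ (g ∘ h)

module Presheaves (C : Category) where
  open Category C

  record PSh : Set₁ where
    field
      F      : Obj → Set
      F-set  : ∀ c → UIP (F c)
      res    : ∀ {c d} → Hom d c → F c → F d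
      res-id : ∀ {c} (x : F c) → res idC x ≡ x
      res-∘  : ∀ {c d e} (f : Hom d c) (g : Hom e d) (x : F c) →
               res (f ∘ g) x ≡ res g (res f x)

  record _⇒_ (Γ Δ : PSh) : Set where
    private
      module Γ = PSh Γ
      module Δ = PSh Δ
    field
      η   : ∀ c → Γ.F c → Δ.F c
      nat : ∀ {c d} (f : Hom d c) (x : Γ.F c) → η d (Γ.res f x) ≡ Δ.res f (η c x)
  open _⇒_ public

  _·_ : {Γ Δ Θ : PSh} → Δ ⇒ Θ → Γ ⇒ Δ → Γ ⇒ Θ
  η (_·_ ψ ρ) c x = η ψ c (η ρ c x)
  nat (_·_ {Γ} {Δ} {Θ} ψ ρ) f x =
    trans (cong (η ψ _) (nat ρ f x)) (nat ψ f (η ρ _ x))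

  record Global (K : PSh) : Set where
    private module K = PSh K
    field
      pt     : ∀ c → K.F c
      pt-nat : ∀ {c d} (f : Hom d c) → K.res f (pt c) ≡ pt d
  open Global public

  -- A type over Γ: a presheaf (of sets) on the category of elements ∫Γ,
  -- whose objects are (c , γ) with γ ∈ Γ(c) and whose arrows
  -- (d , δ) → (c , γ) are arrows f : d → c with Γ(f)(γ) = δ.
  record Ty (Γ : PSh) : Set₁ where
    private module Γ = PSh Γ
    field
      Fam     : (c : Obj) → Γ.F c → Set
      Fam-set : ∀ c γ → UIP (Fam c γ)
      res     : ∀ {c d} (f : Hom d c) {γ : Γ.F c} {δ : Γ.F d} →
                Γ.res f γ ≡ δ → Fam c γ → Fam d δ
      res-id  : ∀ {c} {γ : Γ.F c} (p : Γ.res idC γ ≡ γ) (a : Fam c γ) →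
                res idC p a ≡ a
      res-∘   : ∀ {c d e} (f : Hom d c) (g : Hom e d)
                {γ : Γ.F c} {δ : Γ.F d} {ε : Γ.F e}
                (p : Γ.res f γ ≡ δ) (q : Γ.res g δ ≡ ε) (r : Γ.res (f ∘ g) γ ≡ ε)
                (a : Fam c γ) →
                res (f ∘ g) r a ≡ res g q (res f p a)

  record TyHom {Γ : PSh} (A B : Ty Γ) : Set where
    private
      module Γ = PSh Γ
      module A = Ty A
      module B = Ty B
    field
      ηₜ   : ∀ c (γ : Γ.F c) → A.Fam c γ → B.Fam c γ
      natₜ : ∀ {c d} (f : Hom d c) {γ : Γ.F c} {δ : Γ.F d}
             (p : Γ.res f γ ≡ δ) (a : A.Fam c γ) →
             ηₜ d δ (A.res f p a) ≡ B.res f p (ηₜ c γ a)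
  open TyHom public

  record TyIso {Γ : PSh} (A B : Ty Γ) : Set where
    private module Γ = PSh Γ
    field
      α     : TyHom A B
      β     : TyHom B A
      βα    : ∀ c (γ : Γ.F c) a → ηₜ β c γ (ηₜ α c γ a) ≡ a
      αβ    : ∀ c (γ : Γ.F c) b → ηₜ α c γ (ηₜ β c γ b) ≡ b
  open TyIso public

  record TyEq {Γ : PSh} (A B : Ty Γ) : Set₁ where
    private
      module Γ = PSh Γ
      module A = Ty A
      module B = Ty B
    field
      Fam-≡ : ∀ c (γ : Γ.F c) → A.Fam c γ ≡ B.Fam c γ
      res-≡ : ∀ {c d} (f : Hom d c) {γ : Γ.F c} {δ : Γ.F d}
              (p : Γ.res f γ ≡ δ) (a : A.Fam c γ) →
              coe (Fam-≡ d δ) (A.res f p a) ≡ B.res f p (coe (Fam-≡ c γ) a)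
  open TyEq public

  _[_] : {Γ Δ : PSh} → Ty Γ → Δ ⇒ Γ → Ty Δ
  _[_] {Γ} {Δ} A ρ = record
    { Fam     = λ c δ → A.Fam c (η ρ c δ)
    ; Fam-set = λ c δ → A.Fam-set c (η ρ c δ)
    ; res     = λ f {δ} p a → A.res f (tr f δ p) a
    ; res-id  = λ {c} {δ} p a → A.res-id (tr idC δ p) a
    ; res-∘   = λ f g {γ} {δ} {ε} p q r a →
                  A.res-∘ f g (tr f γ p) (tr g δ q) (tr (f ∘ g) γ r) a
    }
    where
      module A = Ty A
      module Γ = PSh Γ
      module Δ = PSh Δ
      tr : ∀ {c d} (f : Hom d c) (δ : Δ.F c) {δ' : Δ.F d} →
           Δ.res f δ ≡ δ' → Γ.res f (η ρ c δ) ≡ η ρ d δ'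
      tr f δ p = trans (sym (nat ρ f δ)) (cong (η ρ _) p)

  _[_]ₕ : {Γ Δ : PSh} {A B : Ty Γ} → TyHom A B → (ρ : Δ ⇒ Γ) →
          TyHom (A [ ρ ]) (B [ ρ ])
  ηₜ (h [ ρ ]ₕ) c δ a = ηₜ h c (η ρ c δ) a
  natₜ (h [ ρ ]ₕ) f {δ} p a = natₜ h f _ a

  _[_]ᵢ : {Γ Δ : PSh} {A B : Ty Γ} → TyIso A B → (ρ : Δ ⇒ Γ) →
          TyIso (A [ ρ ]) (B [ ρ ])
  α (i [ ρ ]ᵢ) = α i [ ρ ]ₕ
  β (i [ ρ ]ᵢ) = β i [ ρ ]ₕ
  βα (i [ ρ ]ᵢ) c δ a = βα i c (η ρ c δ) a
  αβ (i [ ρ ]ᵢ) c δ b = αβ i c (η ρ c δ) b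

  module Cofib (K : PSh) (⊤ : Global K) where
    private module K = PSh K

    _,[_] : (Γ : PSh) → Γ ⇒ K → PSh
    Γ ,[ φ ] = record
      { F      = λ c → Σ (Γ.F c) (λ γ → η φ c γ ≡ pt ⊤ c)
      ; F-set  = λ c → Σ-UIP (Γ.F-set c) (λ γ → K.F-set c)
      ; res    = λ f x → Γ.res f (proj₁ x) , resP f x
      ; res-id = λ x → Σ-≡ (λ γ → K.F-set _) (Γ.res-id (proj₁ x))
      ; res-∘  = λ f g x → Σ-≡ (λ γ → K.F-set _) (Γ.res-∘ f g (proj₁ x))
      }
      where
        module Γ = PSh Γ
        resP : ∀ {c d} (f : Hom d c) (x : Σ (Γ.F c) (λ γ → η φ c γ ≡ pt ⊤ c)) →
               η φ d (Γ.res f (proj₁ x)) ≡ pt ⊤ d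
        resP f (γ , p) =
          trans (nat φ f γ) (trans (cong (K.res f) p) (pt-nat ⊤ f))

    ι : {Γ : PSh} (φ : Γ ⇒ K) → (Γ ,[ φ ]) ⇒ Γ
    η (ι φ) c x = proj₁ x
    nat (ι φ) f x = refl

    _⁺ : {Γ Δ : PSh} {φ : Γ ⇒ K} (ρ : Δ ⇒ Γ) → (Δ ,[ φ · ρ ]) ⇒ (Γ ,[ φ ])
    η (ρ ⁺) c x = η ρ c (proj₁ x) , proj₂ x
    nat (_⁺ {Γ} ρ) f x = Σ-≡ (λ γ → K.F-set _) (nat ρ f (proj₁ x))

    subIso : {Γ Δ : PSh} (φ : Γ ⇒ K) (ρ : Δ ⇒ Γ)
             {T : Ty Γ} {A : Ty (Γ ,[ φ ])} →
             TyIso A (T [ ι φ ]) → TyIso (A [ _⁺ {φ = φ} ρ ]) ((T [ ρ ]) [ ι (φ · ρ) ])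
    ηₜ (α (subIso φ ρ i)) c x a = ηₜ (α i) c (η (_⁺ {φ = φ} ρ) c x) a
    natₜ (α (subIso {Γ} φ ρ {T} i)) f {x} {y} p a =
      trans (natₜ (α i) f {η ρ⁺ _ x} {η ρ⁺ _ y} (tr f x p) a)
            (cong (λ q → Ty.res T f q (ηₜ (α i) _ (η ρ⁺ _ x) a)) (PSh.F-set Γ _ _ _))
      where ρ⁺ = _⁺ {φ = φ} ρ
            tr = λ f x p → trans (sym (nat ρ⁺ f x)) (cong (η ρ⁺ _) p)
    ηₜ (β (subIso φ ρ i)) c x a = ηₜ (β i) c (η (_⁺ {φ = φ} ρ) c x) a
    natₜ (β (subIso {Γ} φ ρ {T} {A} i)) f {x} {y} p a =
      trans (cong (λ q → ηₜ (β i) _ (η ρ⁺ _ y) (Ty.res T f q a)) (PSh.F-set Γ _ _ _))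
            (natₜ (β i) f {η ρ⁺ _ x} {η ρ⁺ _ y} (tr f x p) a)
      where ρ⁺ = _⁺ {φ = φ} ρ
            tr = λ f x p → trans (sym (nat ρ⁺ f x)) (cong (η ρ⁺ _) p)
    βα (subIso φ ρ i) c x a = βα i c (η (_⁺ {φ = φ} ρ) c x) a
    αβ (subIso φ ρ i) c x b = αβ i c (η (_⁺ {φ = φ} ρ) c x) b

module Submission where

-- Write "φ holds at γ" for φ_c(γ) = ⊤_c; this is a proposition, so the
-- classical metatheory (LEM) decides it at every (c , γ).  The glued type
-- 𝒯(A,T,φ) has fibre A(c,(γ,p)) where φ holds (with witness p) and T(c,γ)
-- where it does not.  Restriction along f : d → c is the restriction of A
-- or of T, except when φ fails at γ but holds at Γ(f)(γ), where we restrict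
-- in T and then cross over with β; the fourth case (φ holds at γ but fails
-- at Γ(f)(γ)) is impossible because φ holding is stable under restriction.
-- The isomorphism 𝒯 ≅ T is α / β where φ holds and the identity elsewhere.

open import Defs
open import Data.Product using (Σ; _×_; _,_; proj₁; proj₂)
open import Relation.Binary.PropositionalEquality using (_≡_; refl; sym; trans; cong; module ≡-Reasoning)
open import Relation.Nullary using (Dec; yes; no)
open import Data.Empty using (⊥-elim)
open import Axiom.UniquenessOfIdentityProofs using (UIP)

coe-argument : {I Y : Set} (X : I → Set) (h : ∀ i → X i → Y) {i j : I}
               (u : i ≡ j) (a : X j) → h i (coe (sym (cong X u)) a) ≡ h j a
coe-argument X h refl a = refl

coe-result : {I Y : Set} (X : I → Set) (h : ∀ i → Y → X i) {i j : I}
             (u : i ≡ j) (y : Y) → coe (cong X u) (h i y) ≡ h j y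
coe-result X h refl y = refl

-- It is defined once, outside the
-- gluing construction, so that gluing over Γ and over Δ (part (3)) produce
-- definitionally the same fibres even for an undetermined decision.
byCases : {P : Set} → Dec P → (P → Set) → Set → Set
byCases (yes p) F G = F p
byCases (no _)  F G = G

module _ (C : Category) where
  open Category C
  open Presheaves C

  res-irrelevant : {Γ : PSh} (A : Ty Γ) {c d : Obj} (f : Hom d c)
                   {γ : PSh.F Γ c} {δ : PSh.F Γ d} (e e' : PSh.res Γ f γ ≡ δ)
                   (a : Ty.Fam A c γ) → Ty.res A f e a ≡ Ty.res A f e' a
  res-irrelevant {Γ} A f e e' a = cong (λ e → Ty.res A f e a) (PSh.F-set Γ _ e e')

module Gluing (C : Category) (K : Presheaves.PSh C) (⊤ : Presheaves.Global C K)
              (lem : LEM) where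
  open Category C
  open Presheaves C
  open Cofib K ⊤
  private module K = PSh K

  module Glue (Γ : PSh) (φ : Γ ⇒ K) (T : Ty Γ) (A : Ty (Γ ,[ φ ]))
              (i : TyIso A (T [ ι φ ])) where
    private
      module Γ = PSh Γ
      module T = Ty T
      module A = Ty A

    Holds : (c : Obj) → Γ.F c → Set
    Holds c γ = η φ c γ ≡ pt ⊤ c

    decide : ∀ c γ → Dec (Holds c γ)
    decide c γ = lem (Holds c γ) (K.F-set c)

    holds-res : ∀ {c d} (f : Hom d c) {γ δ} → Γ.res f γ ≡ δ → Holds c γ → Holds d δ
    holds-res f {γ} refl p = trans (nat φ f γ) (trans (cong (K.res f) p) (pt-nat ⊤ f))

    Φ-≡ : ∀ {c} {x y : PSh.F (Γ ,[ φ ]) c} → proj₁ x ≡ proj₁ y → x ≡ y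
    Φ-≡ = Σ-≡ (λ _ → K.F-set _)

    A-at : ∀ c γ → Holds c γ → Set
    A-at c γ p = A.Fam c (γ , p)

    Glued : ∀ c γ → Dec (Holds c γ) → Set
    Glued c γ x = byCases x (A-at c γ) (T.Fam c γ)

    Glued-set : ∀ c γ x → UIP (Glued c γ x)
    Glued-set c γ (yes p) = A.Fam-set c (γ , p)
    Glued-set c γ (no _)  = T.Fam-set c γ

    resGlued : ∀ {c d} (f : Hom d c) {γ δ} (e : Γ.res f γ ≡ δ)
               (x : Dec (Holds c γ)) (y : Dec (Holds d δ)) → Glued c γ x → Glued d δ y
    resGlued f e (yes _) (yes _) a = A.res f (Φ-≡ e) a
    resGlued f e (yes p) (no ¬q) a = ⊥-elim (¬q (holds-res f e p))
    resGlued f e (no _)  (yes q) t = ηₜ (β i) _ (_ , q) (T.res f e t)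
    resGlued f e (no _)  (no _)  t = T.res f e t

    resGlued-id : ∀ {c} {γ : Γ.F c} (e : Γ.res idC γ ≡ γ) x (a : Glued c γ x) →
                  resGlued idC e x x a ≡ a
    resGlued-id e (yes p) a = A.res-id _ a
    resGlued-id e (no _)  t = T.res-id e t

    -- Functoriality; the only non-trivial case is when φ fails at γ and
    -- holds at δ, where naturality of β moves the crossing point.
    resGlued-∘ : ∀ {c d e} (f : Hom d c) (g : Hom e d) {γ δ ε}
                 (p : Γ.res f γ ≡ δ) (q : Γ.res g δ ≡ ε) (r : Γ.res (f ∘ g) γ ≡ ε)
                 x y z (a : Glued c γ x) →
                 resGlued (f ∘ g) r x z a ≡ resGlued g q y z (resGlued f p x y a)
    resGlued-∘ f g p q r (yes _) (yes _)  (yes _)  a = A.res-∘ f g _ _ _ a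
    resGlued-∘ f g p q r (yes _) (yes py) (no ¬z)  a = ⊥-elim (¬z (holds-res g q py))
    resGlued-∘ f g p q r (yes px) (no ¬y) z        a = ⊥-elim (¬y (holds-res f p px))
    resGlued-∘ f g p q r (no _)  (yes py) (no ¬z)  t = ⊥-elim (¬z (holds-res g q py))
    resGlued-∘ f g p q r (no _)  (yes py) (yes pz) t = begin
        β₍ pz ₎ (T.res (f ∘ g) r t)
      ≡⟨ cong β₍ pz ₎ (T.res-∘ f g p q r t) ⟩
        β₍ pz ₎ (T.res g q (T.res f p t))
      ≡⟨ cong β₍ pz ₎ (res-irrelevant C T g _ _ _) ⟩
        β₍ pz ₎ (T.res g _ (T.res f p t))
      ≡⟨ natₜ (β i) g (Φ-≡ q) (T.res f p t) ⟩
        A.res g (Φ-≡ q) (β₍ py ₎ (T.res f p t)) ∎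
      where
        open ≡-Reasoning
        β₍_₎ : ∀ {e ε} (p : Holds e ε) → T.Fam e ε → A.Fam e (ε , p)
        β₍ p ₎ = ηₜ (β i) _ (_ , p)
    resGlued-∘ f g p q r (no _) (no _) (yes pz) t = cong (ηₜ (β i) _ (_ , pz)) (T.res-∘ f g p q r t)
    resGlued-∘ f g p q r (no _) (no _) (no _)   t = T.res-∘ f g p q r t

    𝒯 : Ty Γ
    𝒯 = record
      { Fam     = λ c γ → Glued c γ (decide c γ)
      ; Fam-set = λ c γ → Glued-set c γ (decide c γ)
      ; res     = λ f {γ} {δ} e → resGlued f e (decide _ γ) (decide _ δ)
      ; res-id  = λ {c} {γ} e → resGlued-id e (decide c γ)
      ; res-∘   = λ f g {γ} {δ} {ε} p q r →
                    resGlued-∘ f g p q r (decide _ γ) (decide _ δ) (decide _ ε)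
      }

    unglue : ∀ c γ x → Glued c γ x → T.Fam c γ
    unglue c γ (yes p) a = ηₜ (α i) c (γ , p) a
    unglue c γ (no _)  t = t

    glue : ∀ c γ x → T.Fam c γ → Glued c γ x
    glue c γ (yes p) t = ηₜ (β i) c (γ , p) t
    glue c γ (no _)  t = t

    unglue-nat : ∀ {c d} (f : Hom d c) {γ δ} (e : Γ.res f γ ≡ δ) x y a →
                 unglue d δ y (resGlued f e x y a) ≡ T.res f e (unglue c γ x a)
    unglue-nat f e (yes _) (yes _) a =
      trans (natₜ (α i) f (Φ-≡ e) a) (res-irrelevant C T f _ _ _)
    unglue-nat f e (yes p) (no ¬q) a = ⊥-elim (¬q (holds-res f e p))
    unglue-nat f e (no _)  (yes q) t = αβ i _ (_ , q) (T.res f e t)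
    unglue-nat f e (no _)  (no _)  t = refl

    glue-nat : ∀ {c d} (f : Hom d c) {γ δ} (e : Γ.res f γ ≡ δ) x y t →
               glue d δ y (T.res f e t) ≡ resGlued f e x y (glue c γ x t)
    glue-nat f e (yes _) (yes q) t =
      trans (cong (ηₜ (β i) _ (_ , q)) (res-irrelevant C T f _ _ _))
            (natₜ (β i) f (Φ-≡ e) t)
    glue-nat f e (yes p) (no ¬q) t = ⊥-elim (¬q (holds-res f e p))
    glue-nat f e (no _)  (yes q) t = refl
    glue-nat f e (no _)  (no _)  t = refl

    glue-unglue : ∀ c γ x a → glue c γ x (unglue c γ x a) ≡ a
    glue-unglue c γ (yes p) a = βα i c (γ , p) a
    glue-unglue c γ (no _)  a = refl

    unglue-glue : ∀ c γ x t → unglue c γ x (glue c γ x t) ≡ t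
    unglue-glue c γ (yes p) t = αβ i c (γ , p) t
    unglue-glue c γ (no _)  t = refl

    iso : TyIso 𝒯 T
    iso = record
      { α  = record { ηₜ   = λ c γ → unglue c γ (decide c γ)
                    ; natₜ = λ f {γ} {δ} e → unglue-nat f e (decide _ γ) (decide _ δ) }
      ; β  = record { ηₜ   = λ c γ → glue c γ (decide c γ)
                    ; natₜ = λ f {γ} {δ} e → glue-nat f e (decide _ γ) (decide _ δ) }
      ; βα = λ c γ → glue-unglue c γ (decide c γ)
      ; αβ = λ c γ → unglue-glue c γ (decide c γ)
      }

    Glued-on-Φ : ∀ c γ (p : Holds c γ) x → Glued c γ x ≡ A-at c γ p
    Glued-on-Φ c γ p (yes p') = cong (A-at c γ) (K.F-set c p' p)
    Glued-on-Φ c γ p (no ¬p)  = ⊥-elim (¬p p)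

    A-res-reindex : ∀ {c d} (f : Hom d c) {γ δ} {p p' : Holds c γ} {q q' : Holds d δ}
                    (e  : PSh.res (Γ ,[ φ ]) f (γ , p)  ≡ (δ , q))
                    (e' : PSh.res (Γ ,[ φ ]) f (γ , p') ≡ (δ , q'))
                    (u : p' ≡ p) (v : q' ≡ q) a →
                    coe (cong (A-at d δ) v) (A.res f e' a) ≡ A.res f e (coe (cong (A-at c γ) u) a)
    A-res-reindex f e e' refl refl a = res-irrelevant C A f e' e a

    -- Restriction in 𝒯 over Γ,[φ] is restriction in A; the path
    -- trans (sym refl) (cong proj₁ e) is the one produced by _[ ι φ ].
    resGlued-on-Φ : ∀ {c d} (f : Hom d c) {γ δ} {p : Holds c γ} {q : Holds d δ}
                    (e : PSh.res (Γ ,[ φ ]) f (γ , p) ≡ (δ , q)) x y a →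
                    coe (Glued-on-Φ d δ q y) (resGlued f (trans (sym refl) (cong proj₁ e)) x y a)
                    ≡ A.res f e (coe (Glued-on-Φ c γ p x) a)
    resGlued-on-Φ f e (yes _) (yes _) a = A-res-reindex f e _ _ _ a
    resGlued-on-Φ f {q = q} e (yes _) (no ¬q) a = ⊥-elim (¬q q)
    resGlued-on-Φ f {p = p} e (no ¬p) y a = ⊥-elim (¬p p)

    restrict-≡ : TyEq (𝒯 [ ι φ ]) A
    restrict-≡ = record
      { Fam-≡ = λ c x → Glued-on-Φ c (proj₁ x) (proj₂ x) (decide c (proj₁ x))
      ; res-≡ = λ f {x} {y} e → resGlued-on-Φ f e (decide _ (proj₁ x)) (decide _ (proj₁ y))
      }

    unglue-on-Φ : ∀ c γ (p : Holds c γ) x a →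
                  unglue c γ x (coe (sym (Glued-on-Φ c γ p x)) a) ≡ ηₜ (α i) c (γ , p) a
    unglue-on-Φ c γ p (yes p') a =
      coe-argument (A-at c γ) (λ r → ηₜ (α i) c (γ , r)) (K.F-set c p' p) a
    unglue-on-Φ c γ p (no ¬p) a = ⊥-elim (¬p p)

    glue-on-Φ : ∀ c γ (p : Holds c γ) x t →
                coe (Glued-on-Φ c γ p x) (glue c γ x t) ≡ ηₜ (β i) c (γ , p) t
    glue-on-Φ c γ p (yes p') t =
      coe-result (A-at c γ) (λ r → ηₜ (β i) c (γ , r)) (K.F-set c p' p) t
    glue-on-Φ c γ p (no ¬p) t = ⊥-elim (¬p p)

  module Stability (Γ Δ : PSh) (φ : Γ ⇒ K) (ρ : Δ ⇒ Γ) (T : Ty Γ) (A : Ty (Γ ,[ φ ]))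
                   (i : TyIso A (T [ ι φ ])) where
    private
      module Δ = PSh Δ
      module GΓ = Glue Γ φ T A i
      module GΔ = Glue Δ (φ · ρ) (T [ ρ ]) (A [ _⁺ {φ = φ} ρ ]) (subIso φ ρ {T} {A} i)

    resGlued-subst : ∀ {c d} (f : Hom d c) {δ : Δ.F c} {δ' : Δ.F d}
                     (p : Δ.res f δ ≡ δ') x y a →
                     GΓ.resGlued f (trans (sym (nat ρ f δ)) (cong (η ρ _) p)) x y a
                     ≡ GΔ.resGlued f p x y a
    resGlued-subst f p (yes _) (yes _)  a = res-irrelevant C A f _ _ a
    resGlued-subst f p (yes q) (no ¬q') a = ⊥-elim (¬q' (GΔ.holds-res f p q))
    resGlued-subst f p (no _)  (yes q') t = cong (ηₜ (β i) _ (_ , q')) (res-irrelevant C T f _ _ t)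
    resGlued-subst f p (no _)  (no _)   t = res-irrelevant C T f _ _ t

    subst-≡ : TyEq (GΓ.𝒯 [ ρ ]) GΔ.𝒯
    subst-≡ = record
      { Fam-≡ = λ c δ → refl
      ; res-≡ = λ f {δ} {δ'} p → resGlued-subst f p (GΔ.decide _ δ) (GΔ.decide _ δ')
      }

mainTheorem2 : (C : Category) → let open Presheaves C in
    (K : PSh) (⊤ : Global K) → LEM →
    let open Cofib K ⊤ in
    Σ ((Γ : PSh) (φ : Γ ⇒ K) (T : Ty Γ) (A : Ty (Γ ,[ φ ])) →
    TyIso A (T [ ι φ ]) → Ty Γ) λ 𝒯 →
    ((Γ : PSh) (φ : Γ ⇒ K) (T : Ty Γ) (A : Ty (Γ ,[ φ ]))
    (i : TyIso A (T [ ι φ ])) →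
    Σ (TyEq (𝒯 Γ φ T A i [ ι φ ]) A) λ e →
    Σ (TyIso (𝒯 Γ φ T A i) T) λ i' →
    ((c : Category.Obj C) (x : PSh.F (Γ ,[ φ ]) c) (a : Ty.Fam A c x) →
    ηₜ (α i') c (proj₁ x) (coe (sym (Fam-≡ e c x)) a) ≡ ηₜ (α i) c x a)
    × ((c : Category.Obj C) (x : PSh.F (Γ ,[ φ ]) c) (t : Ty.Fam T c (proj₁ x)) →
    coe (Fam-≡ e c x) (ηₜ (β i') c (proj₁ x) t) ≡ ηₜ (β i) c x t))
    × ((Γ Δ : PSh) (φ : Γ ⇒ K) (ρ : Δ ⇒ Γ) (T : Ty Γ) (A : Ty (Γ ,[ φ ]))
    (i : TyIso A (T [ ι φ ])) →
    TyEq (𝒯 Γ φ T A i [ ρ ])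
    (𝒯 Δ (φ · ρ) (T [ ρ ]) (A [ _⁺ {φ = φ} ρ ]) (subIso φ ρ {T} {A} i)))
mainTheorem2 C K ⊤ lem =
  (λ Γ φ T A i → Glue.𝒯 Γ φ T A i) ,
  (λ Γ φ T A i → let open Glue Γ φ T A i in
     restrict-≡ , iso ,
     (λ c x a → unglue-on-Φ c (proj₁ x) (proj₂ x) (decide c (proj₁ x)) a) ,
     (λ c x t → glue-on-Φ c (proj₁ x) (proj₂ x) (decide c (proj₁ x)) t)) ,
  Stability.subst-≡
  where open Gluing C K ⊤ lem
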